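{- Let $\mathcal{G}$ be a set of positions closed under options, partitioned into disjoint sets $\mathcal{D}$ and $\mathcal{S}$ such that (a) every $G\in\mathcal{D}$ has at least one of the $\Diamond$-, $\Diamond^{\le}$-, $\Diamond_L^{\ngeq}$-, or $\Diamond_R^{\ngeq}$-properties; (b) for every $G\in\mathcal{S}$, all Left and Right options of $G$ belong to $\mathcal{D}$; and (c) for every $G\in\mathcal{D}$, every Right option of every Left option of $G$ and every Left option of every Right option of $G$ belongs to $\mathcal{D}$. Then (1) every $G\in\mathcal{G}$ is equal to $\{m\mid n\}$ for some integers $m,n$, and (2) every $G\in\mathcal{D}$ is equal to an integer.
   Context: Positions are short (finite, loop-free) combinatorial games $G=\{G^{\mathcal L}\mid G^{\mathcal R}\}$ with finite sets of Left/Right options; $G^L$, $G^R$ denote individual options, $G^{LR}$ a Right option of a Left option $G^L$, and $G^{RL}$ a Left option of a Right option $G^R$. A set is closed under options if every option of a member is a member. Relations $=,\le,<$ are the usual ones; $G\ngeq H$ means "$G<H$ or $G$ is fuzzy with $H$". "$G\in\mathbb{Z}$" means $G$ equals an integer. Integer stops: $\mathrm{LS}(G)=\mathrm{RS}(G)=$ the integer equal to $G$ if $G\in\mathbb{Z}$; otherwise $\mathrm{LS}(G)=\max_{G^L}\mathrm{RS}(G^L)$, $\mathrm{RS}(G)=\min_{G^R}\mathrm{LS}(G^R)$. Guide options: $\mathrm{gd}^L(G)=\emptyset$ if $G\in\mathbb{Z}$; if $G\notin\mathbb{Z}$ and some Left option equals $\mathrm{LS}(G)$, then $\mathrm{gd}^L(G)=\{G^L:G^L=\mathrm{LS}(G)\}$;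 otherwise $\mathrm{gd}^L(G)=\{G^L:\mathrm{RS}(G^L)=\mathrm{LS}(G)\}$; dually $\mathrm{gd}^R(G)=\emptyset$ if $G\in\mathbb{Z}$; if $G\notin\mathbb{Z}$ and some Right option equals $\mathrm{RS}(G)$ then $\mathrm{gd}^R(G)=\{G^R:G^R=\mathrm{RS}(G)\}$; otherwise $\mathrm{gd}^R(G)=\{G^R:\mathrm{LS}(G^R)=\mathrm{RS}(G)\}$. Each of the following properties holds for $G$ if $G\in\mathbb{Z}$, or otherwise if there exist $G^L\in\mathrm{gd}^L(G)$ and $G^R\in\mathrm{gd}^R(G)$ such that: ($\Diamond$) there is a position $H$ that is a Right option of $G^L$ and a Left option of $G^R$; ($\Diamond^{\le}$) there are a Right option $G^{LR}$ of $G^L$ and a Left option $G^{RL}$ of $G^R$ with $G^{LR}\le G^{RL}$; ($\Diamond_L^{\ngeq}$) there is a Right option $G^{LR}$ of $G^L$ with $G^{LR}\ngeq G^R$; ($\Diamond_R^{\ngeq}$) there is a Left option $G^{RL}$ of $G^R$ with $G^L\ngeq G^{RL}$. -}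

module Defs where

open import Data.List using (List; []; _∷_)
open import Data.List.Membership.Propositional using (_∈_)
open import Data.Integer as ℤ using (ℤ; +_; -[1+_])
open import Data.Nat using (ℕ; zero; suc)
open import Data.Product using (Σ; _×_; _,_; ∃-syntax)
open import Data.Sum using (_⊎_)
open import Data.Unit using (⊤)
open import Data.Empty using (⊥)
open import Relation.Nullary using (¬_)

data Game : Set where
  ⟨_∣_⟩ : List Game → List Game → Game

left : Game → List Game
left ⟨ L ∣ R ⟩ = L

right : Game → List Game
right ⟨ L ∣ R ⟩ = R

mutual
  infix 4 _≤g_
  _≤g_ : Game → Game → Set
  ⟨ L₁ ∣ R₁ ⟩ ≤g ⟨ L₂ ∣ R₂ ⟩ = NoLeftAbove L₁ ⟨ L₂ ∣ R₂ ⟩ × NoRightBelow R₂ ⟨ L₁ ∣ R₁ ⟩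

  NoLeftAbove : List Game → Game → Set
  NoLeftAbove [] H = ⊤
  NoLeftAbove (x ∷ xs) H = ¬ (H ≤g x) × NoLeftAbove xs H

  NoRightBelow : List Game → Game → Set
  NoRightBelow [] G = ⊤
  NoRightBelow (y ∷ ys) G = ¬ (y ≤g G) × NoRightBelow ys G

infix 4 _≈g_ _<g_ _≱g_
_≈g_ : Game → Game → Set
G ≈g H = G ≤g H × H ≤g G

_<g_ : Game → Game → Set
G <g H = G ≤g H × ¬ (H ≤g G)

_≱g_ : Game → Game → Set
G ≱g H = ¬ (H ≤g G)

natG : ℕ → Game
natG zero = ⟨ [] ∣ [] ⟩
natG (suc n) = ⟨ natG n ∷ [] ∣ [] ⟩

negNatG : ℕ → Game
negNatG zero = ⟨ [] ∣ [] ⟩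
negNatG (suc n) = ⟨ [] ∣ negNatG n ∷ [] ⟩

intG : ℤ → Game
intG (+ n) = natG n
intG -[1+ n ] = negNatG (suc n)

IsInt : Game → Set
IsInt G = Σ ℤ λ n → G ≈g intG n

-- Integer stops, as relations: LSis G s means LS(G) = s, RSis G s means RS(G) = s.
-- LS(G) = the integer equal to G if G ∈ ℤ, otherwise max over G^L of RS(G^L);
-- RS(G) = the integer equal to G if G ∈ ℤ, otherwise min over G^R of LS(G^R).

mutual
  LSis : Game → ℤ → Set
  LSis ⟨ L ∣ R ⟩ s =
    (⟨ L ∣ R ⟩ ≈g intG s) ⊎ (¬ IsInt ⟨ L ∣ R ⟩ × AttRS L s × UpperRS L s)

  RSis : Game → ℤ → Set
  RSis ⟨ L ∣ R ⟩ s =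
    (⟨ L ∣ R ⟩ ≈g intG s) ⊎ (¬ IsInt ⟨ L ∣ R ⟩ × AttLS R s × LowerLS R s)

  AttRS : List Game → ℤ → Set
  AttRS [] s = ⊥
  AttRS (x ∷ xs) s = RSis x s ⊎ AttRS xs s

  UpperRS : List Game → ℤ → Set
  UpperRS [] s = ⊤
  UpperRS (x ∷ xs) s = (∀ t → RSis x t → t ℤ.≤ s) × UpperRS xs s

  AttLS : List Game → ℤ → Set
  AttLS [] s = ⊥
  AttLS (x ∷ xs) s = LSis x s ⊎ AttLS xs s

  LowerLS : List Game → ℤ → Set
  LowerLS [] s = ⊤
  LowerLS (x ∷ xs) s = (∀ t → LSis x t → s ℤ.≤ t) × LowerLS xs s

gdL : Game → Game → Set
gdL G GL =
  ¬ IsInt G × GL ∈ left G ×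
  Σ ℤ λ s → LSis G s ×
    ( ((Σ Game λ K → K ∈ left G × K ≈g intG s) × GL ≈g intG s)
    ⊎ (¬ (Σ Game λ K → K ∈ left G × K ≈g intG s) × RSis GL s))

gdR : Game → Game → Set
gdR G GR =
  ¬ IsInt G × GR ∈ right G ×
  Σ ℤ λ s → RSis G s ×
    ( ((Σ Game λ K → K ∈ right G × K ≈g intG s) × GR ≈g intG s)
    ⊎ (¬ (Σ Game λ K → K ∈ right G × K ≈g intG s) × LSis GR s))

DiamondProp : Game → Set
DiamondProp G = IsInt G ⊎
  (Σ Game λ GL → Σ Game λ GR → gdL G GL × gdR G GR ×
     (Σ Game λ H → H ∈ right GL × H ∈ left GR))

DiamondLeProp : Game → Set
DiamondLeProp G = IsInt G ⊎
  (Σ Game λ GL → Σ Game λ GR → gdL G GL × gdR G GR ×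
     (Σ Game λ GLR → Σ Game λ GRL → GLR ∈ right GL × GRL ∈ left GR × GLR ≤g GRL))

DiamondNgeqLProp : Game → Set
DiamondNgeqLProp G = IsInt G ⊎
  (Σ Game λ GL → Σ Game λ GR → gdL G GL × gdR G GR ×
     (Σ Game λ GLR → GLR ∈ right GL × GLR ≱g GR))

DiamondNgeqRProp : Game → Set
DiamondNgeqRProp G = IsInt G ⊎
  (Σ Game λ GL → Σ Game λ GR → gdL G GL × gdR G GR ×
     (Σ Game λ GRL → GRL ∈ left GR × GL ≱g GRL))

HasSomeDiamond : Game → Set
HasSomeDiamond G =
  DiamondProp G ⊎ DiamondLeProp G ⊎ DiamondNgeqLProp G ⊎ DiamondNgeqRProp G

ClosedUnderOptions : (Game → Set) → Set
ClosedUnderOptions 𝒢 =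
  ∀ G → 𝒢 G → (∀ K → K ∈ left G → 𝒢 K) × (∀ K → K ∈ right G → 𝒢 K)

IsPartition : (Game → Set) → (Game → Set) → (Game → Set) → Set
IsPartition 𝒢 𝒟 𝒮 =
  (∀ G → 𝒢 G → 𝒟 G ⊎ 𝒮 G) × (∀ G → 𝒟 G → 𝒢 G) × (∀ G → 𝒮 G → 𝒢 G) ×
  (∀ G → 𝒟 G → 𝒮 G → ⊥)

{-# OPTIONS --safe #-}
-- By induction on positions: every position of 𝒢 is an integer or equals {LS ∣ RS}
-- with RS ≤ LS + 1, and every position of 𝒟 is an integer. If G ∈ 𝒮, its options
-- are integers, so G is either an integer lying between its best Left and best Right
-- options or equals {max ∣ min}. If G ∈ 𝒟, its options have the shape above, so a
-- Left guide option Gᴸ yields an integer lo such that every integer ≥ lo exceeds all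
-- Left options while every integer < lo is ≤ Gᴸ; dually Gᴿ yields hi. Each diamond
-- property provides an option X of Gᴸ or of Gᴿ, an integer by (c), with Gᴸ ≱g X
-- and X ≱g Gᴿ. Hence lo ≤ X ≤ hi, and by the simplicity theorem G equals an integer of
-- [lo, hi].
module Submission where

open import Defs
open import Data.List.Membership.Propositional using (_∈_)
open import Data.List using ([]; _∷_)
open import Data.Integer using (ℤ)
open import Data.Product using (Σ; _×_)

open import Data.List using (List)
open import Data.List.Relation.Unary.Any using (here; there)
open import Data.Integer
  using (+_; -[1+_]; 0ℤ; pred; _≤_; _<_; _≤?_; _<?_; +≤+; -≤-; -≤+; +<+; -<-; -<+)
  renaming (suc to sucℤ)
open import Data.Integer.Properties
  using ( ≤-refl; ≤-trans; ≤-antisym; ≤-<-trans; <⇒≤; <-irrefl; <-asym; <-≤-trans; <⇒≱; ≰⇒>; ≮⇒≥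
        ; i≤suc[i]; suc[i]≤j⇒i<j; i<j⇒suc[i]≤j; suc-pred; pred-suc
        ; i≤pred[j]⇒i<j; i<j⇒i≤pred[j]; i≤j⇒pred[i]≤j; i⊓j≤i; i⊓j≤j; i≤i⊔j; i≤j⊔i)
open import Data.Nat as ℕ using (ℕ; zero; suc; s≤s)
import Data.Nat.Properties as ℕ
open import Data.Nat.Induction using (<-wellFounded)
open import Induction.WellFounded using (Acc; acc)
open import Data.Product using (_,_; proj₁; proj₂)
open import Data.Sum using (_⊎_; inj₁; inj₂; [_,_]′)
open import Data.Empty using (⊥-elim)
open import Data.Unit using (tt)
open import Relation.Nullary using (¬_; yes; no)
open import Function using (_∘_)
open import Relation.Binary.PropositionalEquality using (_≡_; refl; sym; trans; subst)

variable
  G H X Y Z x y z GL GR : Game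
  xs : List Game
  a b k m n s t v lo hi : ℤ

noLeftAbove⁻ : NoLeftAbove xs H → x ∈ xs → ¬ H ≤g x
noLeftAbove⁻ {xs = _ ∷ _} (p , _) (here refl) = p
noLeftAbove⁻ {xs = _ ∷ _} (_ , ps) (there x∈) = noLeftAbove⁻ ps x∈

noLeftAbove⁺ : ∀ xs → (∀ x → x ∈ xs → ¬ H ≤g x) → NoLeftAbove xs H
noLeftAbove⁺ [] _ = tt
noLeftAbove⁺ (x ∷ xs) f = f x (here refl) , noLeftAbove⁺ xs (λ z z∈ → f z (there z∈))

noRightBelow⁻ : NoRightBelow xs H → y ∈ xs → ¬ y ≤g H
noRightBelow⁻ {xs = _ ∷ _} (p , _) (here refl) = p
noRightBelow⁻ {xs = _ ∷ _} (_ , ps) (there y∈) = noRightBelow⁻ ps y∈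

noRightBelow⁺ : ∀ xs → (∀ y → y ∈ xs → ¬ y ≤g H) → NoRightBelow xs H
noRightBelow⁺ [] _ = tt
noRightBelow⁺ (y ∷ ys) f = f y (here refl) , noRightBelow⁺ ys (λ z z∈ → f z (there z∈))

≤g⁺ : (∀ x → x ∈ left X → x ≱g Y) → (∀ y → y ∈ right Y → X ≱g y) → X ≤g Y
≤g⁺ {⟨ L ∣ _ ⟩} {⟨ _ ∣ R ⟩} f g = noLeftAbove⁺ L f , noRightBelow⁺ R g

≤g⁻ˡ : X ≤g Y → x ∈ left X → x ≱g Y
≤g⁻ˡ {⟨ _ ∣ _ ⟩} {⟨ _ ∣ _ ⟩} (p , _) = noLeftAbove⁻ p

≤g⁻ʳ : X ≤g Y → y ∈ right Y → X ≱g y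
≤g⁻ʳ {⟨ _ ∣ _ ⟩} {⟨ _ ∣ _ ⟩} (_ , q) = noRightBelow⁻ q

mutual
  size : Game → ℕ
  size ⟨ L ∣ R ⟩ = suc (sizes L ℕ.+ sizes R)

  sizes : List Game → ℕ
  sizes [] = 0
  sizes (x ∷ xs) = size x ℕ.+ sizes xs

∈⇒size≤sizes : x ∈ xs → size x ℕ.≤ sizes xs
∈⇒size≤sizes {xs = x ∷ xs} (here refl) = ℕ.m≤m+n (size x) (sizes xs)
∈⇒size≤sizes {xs = z ∷ xs} (there x∈) = ℕ.≤-trans (∈⇒size≤sizes x∈) (ℕ.m≤n+m (sizes xs) (size z))

left-size : x ∈ left G → size x ℕ.< size G
left-size {G = ⟨ L ∣ R ⟩} x∈ = s≤s (ℕ.≤-trans (∈⇒size≤sizes x∈) (ℕ.m≤m+n (sizes L) (sizes R)))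

right-size : y ∈ right G → size y ℕ.< size G
right-size {G = ⟨ L ∣ R ⟩} y∈ = s≤s (ℕ.≤-trans (∈⇒size≤sizes y∈) (ℕ.m≤n+m (sizes R) (sizes L)))

size-rec : (P : Game → Set) → (∀ G → (∀ H → size H ℕ.< size G → P H) → P G) → ∀ G → P G
size-rec P step G = go G (<-wellFounded (size G))
  where
  go : ∀ G → Acc ℕ._<_ (size G) → P G
  go G (acc rec) = step G (λ H lt → go H (rec lt))

≤g-refl : ∀ G → G ≤g G
≤g-refl = size-rec (λ G → G ≤g G) λ G ih →
  ≤g⁺ (λ x x∈ G≤x → ≤g⁻ˡ G≤x x∈ (ih x (left-size x∈)))
      (λ y y∈ y≤G → ≤g⁻ʳ y≤G y∈ (ih y (right-size y∈)))

left≱ : x ∈ left G → x ≱g G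
left≱ x∈ G≤x = ≤g⁻ˡ G≤x x∈ (≤g-refl _)

≱right : y ∈ right G → G ≱g y
≱right y∈ y≤G = ≤g⁻ʳ y≤G y∈ (≤g-refl _)

size³ : Game → Game → Game → ℕ
size³ X Y Z = size X ℕ.+ size Y ℕ.+ size Z

size³-rotate : ∀ X Y Z → size³ X Y Z ≡ size³ Y Z X
size³-rotate X Y Z = trans (ℕ.+-assoc (size X) (size Y) (size Z)) (ℕ.+-comm (size X) (size Y ℕ.+ size Z))

size³-rotate-left : x ∈ left X → size³ Y Z x ℕ.< size³ X Y Z
size³-rotate-left {X = X} {Y} {Z} x∈ = ℕ.<-≤-trans
  (ℕ.+-monoʳ-< (size Y ℕ.+ size Z) (left-size x∈)) (ℕ.≤-reflexive (sym (size³-rotate X Y Z)))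

size³-rotate-right : z ∈ right Z → size³ z X Y ℕ.< size³ X Y Z
size³-rotate-right {z} {Z} {X} {Y} z∈ = ℕ.≤-<-trans
  (ℕ.≤-reflexive (size³-rotate z X Y)) (ℕ.+-monoʳ-< (size X ℕ.+ size Y) (right-size z∈))

≤g-trans : X ≤g Y → Y ≤g Z → X ≤g Z
≤g-trans = go (<-wellFounded _)
  where
  go : Acc ℕ._<_ (size³ X Y Z) → X ≤g Y → Y ≤g Z → X ≤g Z
  go {X} {Y} {Z} (acc rec) X≤Y Y≤Z = ≤g⁺
    (λ x x∈ Z≤x → ≤g⁻ˡ X≤Y x∈ (go (rec (size³-rotate-left {Y = Y} {Z} x∈)) Y≤Z Z≤x))
    (λ z z∈ z≤X → ≤g⁻ʳ Y≤Z z∈ (go (rec (size³-rotate-right {X = X} {Y} z∈)) z≤X X≤Y))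

≈g-refl : G ≈g G
≈g-refl = ≤g-refl _ , ≤g-refl _

≈g-sym : X ≈g Y → Y ≈g X
≈g-sym (p , q) = q , p

≈g-trans : X ≈g Y → Y ≈g Z → X ≈g Z
≈g-trans (p , q) (r , s) = ≤g-trans p r , ≤g-trans s q

≱g-≤g-trans : X ≱g Y → Y ≤g Z → X ≱g Z
≱g-≤g-trans X≱Y Y≤Z Z≤X = X≱Y (≤g-trans Y≤Z Z≤X)

≤g-≱g-trans : X ≤g Y → Y ≱g Z → X ≱g Z
≤g-≱g-trans X≤Y Y≱Z Z≤X = Y≱Z (≤g-trans Z≤X X≤Y)

natG-right : ∀ n → ¬ y ∈ right (natG n)
natG-right zero ()
natG-right (suc n) ()

negNatG-left : ∀ n → ¬ x ∈ left (negNatG n)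
negNatG-left zero ()
negNatG-left (suc n) ()

negNatG≤natG : ∀ m n → negNatG m ≤g natG n
negNatG≤natG m n = ≤g⁺ (λ _ x∈ → ⊥-elim (negNatG-left m x∈)) (λ _ y∈ → ⊥-elim (natG-right n y∈))

mutual
  natG-mono : ∀ {m n} → m ℕ.≤ n → natG m ≤g natG n
  natG-mono {zero} {n} _ = ≤g⁺ (λ _ ()) (λ _ y∈ → ⊥-elim (natG-right n y∈))
  natG-mono {suc m} {n} m<n = ≤g⁺ (λ { _ (here refl) → natG-<⇒≰ m<n ; _ (there ()) })
                                  (λ _ y∈ → ⊥-elim (natG-right n y∈))

  natG-<⇒≰ : ∀ {m n} → n ℕ.< m → ¬ natG m ≤g natG n
  natG-<⇒≰ {suc m} (s≤s n≤m) m≤n = ≤g⁻ˡ m≤n (here refl) (natG-mono n≤m)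

mutual
  negNatG-antitone : ∀ {m n} → n ℕ.≤ m → negNatG m ≤g negNatG n
  negNatG-antitone {m} {zero} _ = ≤g⁺ (λ _ x∈ → ⊥-elim (negNatG-left m x∈)) (λ _ ())
  negNatG-antitone {m} {suc n} n<m = ≤g⁺ (λ _ x∈ → ⊥-elim (negNatG-left m x∈))
                                         (λ { _ (here refl) → negNatG-<⇒≰ n<m ; _ (there ()) })

  negNatG-<⇒≰ : ∀ {m n} → m ℕ.< n → ¬ negNatG m ≤g negNatG n
  negNatG-<⇒≰ {n = suc n} (s≤s m≤n) m≤n' = ≤g⁻ʳ m≤n' (here refl) (negNatG-antitone m≤n)

natG≰negNatG : ∀ m n → ¬ natG m ≤g negNatG (suc n)
natG≰negNatG m n m≤n = ≤g⁻ʳ m≤n (here refl) (negNatG≤natG n m)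

intG-mono : a ≤ b → intG a ≤g intG b
intG-mono (-≤- n≤m) = negNatG-antitone (s≤s n≤m)
intG-mono (-≤+ {m} {n}) = negNatG≤natG (suc m) n
intG-mono (+≤+ m≤n) = natG-mono m≤n

intG-<⇒≰ : b < a → ¬ intG a ≤g intG b
intG-<⇒≰ (-<- n<m) = negNatG-<⇒≰ (s≤s n<m)
intG-<⇒≰ (-<+ {m} {n}) = natG≰negNatG n m
intG-<⇒≰ (+<+ m<n) = natG-<⇒≰ m<n

intG-≤⁻ : intG a ≤g intG b → a ≤ b
intG-≤⁻ a≤b = ≮⇒≥ (λ b<a → intG-<⇒≰ b<a a≤b)

intG-≰⁻ : ¬ intG a ≤g intG b → b < a
intG-≰⁻ a≰b = ≰⇒> (λ a≤b → a≰b (intG-mono a≤b))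

intG-left : x ∈ left (intG k) → 0ℤ < k × x ≡ intG (pred k)
intG-left {k = + suc n} (here refl) = +<+ (s≤s ℕ.z≤n) , refl

intG-right : y ∈ right (intG k) → k < 0ℤ × y ≡ intG (sucℤ k)
intG-right {k = + n} y∈ = ⊥-elim (natG-right n y∈)
intG-right {k = -[1+ zero ]} (here refl) = -<+ , refl
intG-right {k = -[1+ suc n ]} (here refl) = -<+ , refl

≈intG-unique : G ≈g intG a → G ≈g intG b → a ≡ b
≈intG-unique (G≤a , a≤G) (G≤b , b≤G) =
  ≤-antisym (intG-≤⁻ (≤g-trans a≤G G≤b)) (intG-≤⁻ (≤g-trans b≤G G≤a))

<suc⇒≤ : a < sucℤ b → a ≤ b
<suc⇒≤ {a} {b} a<1+b = subst (a ≤_) (pred-suc b) (i<j⇒i≤pred[j] a<1+b)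

pred<⇒≤ : pred a < b → a ≤ b
pred<⇒≤ {a} {b} a-1<b = subst (_≤ b) (suc-pred a) (i<j⇒suc[i]≤j a-1<b)

-- Simplicity for integers

AboveLeft : Game → ℤ → Set
AboveLeft G k = ∀ x → x ∈ left G → x ≱g intG k

BelowRight : Game → ℤ → Set
BelowRight G k = ∀ y → y ∈ right G → intG k ≱g y

LeftReaches : Game → ℤ → Set
LeftReaches G k = Σ Game λ x → x ∈ left G × intG k ≤g x

RightReaches : Game → ℤ → Set
RightReaches G k = Σ Game λ y → y ∈ right G × y ≤g intG k

≈intG⁺ : ∀ k → AboveLeft G k → BelowRight G k →
  (0ℤ < k → LeftReaches G (pred k)) → (k < 0ℤ → RightReaches G (sucℤ k)) → G ≈g intG k
≈intG⁺ {G} k above below reachesL reachesR = ≤g⁺ above k-right , ≤g⁺ k-left below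
  where
  k-right : ∀ y → y ∈ right (intG k) → G ≱g y
  k-right y y∈ y≤G with intG-right {k = k} y∈
  ... | k<0 , refl with reachesR k<0
  ... | z , z∈ , z≤y = ≤g⁻ʳ y≤G z∈ z≤y

  k-left : ∀ x → x ∈ left (intG k) → x ≱g G
  k-left x x∈ G≤x with intG-left {k = k} x∈
  ... | 0<k , refl with reachesL 0<k
  ... | z , z∈ , x≤z = ≤g⁻ˡ G≤x z∈ x≤z

LowerEnd : Game → ℤ → Set
LowerEnd G lo = (∀ k → lo ≤ k → AboveLeft G k) × (0ℤ < lo → LeftReaches G (pred lo))

UpperEnd : Game → ℤ → Set
UpperEnd G hi = (∀ k → k ≤ hi → BelowRight G k) × (hi < 0ℤ → RightReaches G (sucℤ hi))

-- G equals the integer of [lo, hi] closest to 0.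
isInt-between : lo ≤ hi → LowerEnd G lo → UpperEnd G hi → IsInt G
isInt-between {lo} {hi} lo≤hi (above , reachesL) (below , reachesR) with 0ℤ <? lo | hi <? 0ℤ
... | yes 0<lo | _ = lo , ≈intG⁺ lo (above lo ≤-refl) (below lo lo≤hi) reachesL
                           (λ lo<0 → ⊥-elim (<-asym lo<0 0<lo))
... | no _ | yes hi<0 = hi , ≈intG⁺ hi (above hi lo≤hi) (below hi ≤-refl)
                           (λ 0<hi → ⊥-elim (<-asym hi<0 0<hi)) reachesR
... | no 0≮lo | no hi≮0 = 0ℤ , ≈intG⁺ 0ℤ (above 0ℤ (≮⇒≥ 0≮lo)) (below 0ℤ (≮⇒≥ hi≮0))
                           (λ 0<0 → ⊥-elim (<-irrefl refl 0<0)) (λ 0<0 → ⊥-elim (<-irrefl refl 0<0))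

leftReaches : x ∈ left G → (∀ h → h < lo → intG h ≤g x) → LeftReaches G (pred lo)
leftReaches {x} x∈ below = x , x∈ , below _ (i≤pred[j]⇒i<j ≤-refl)

rightReaches : y ∈ right G → (∀ h → hi < h → y ≤g intG h) → RightReaches G (sucℤ hi)
rightReaches {y} y∈ above = y , y∈ , above _ (suc[i]≤j⇒i<j ≤-refl)

⟪_∣_⟫ : ℤ → ℤ → Game
⟪ m ∣ n ⟫ = ⟨ intG m ∷ [] ∣ intG n ∷ [] ⟩

intG≤⟪⟫⁻ : intG k ≤g ⟪ m ∣ n ⟫ → k < n
intG≤⟪⟫⁻ k≤mn = intG-≰⁻ (≤g⁻ʳ k≤mn (here refl))

⟪⟫≤intG⁻ : ⟪ m ∣ n ⟫ ≤g intG k → m < k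
⟪⟫≤intG⁻ mn≤k = intG-≰⁻ (≤g⁻ˡ mn≤k (here refl))

intG≤⟪⟫⁺ : n ≤ sucℤ m → k < n → intG k ≤g ⟪ m ∣ n ⟫
intG≤⟪⟫⁺ {n} {m} {k} n≤1+m k<n = ≤g⁺ k-left mn-right
  where
  k-left : ∀ x → x ∈ left (intG k) → x ≱g ⟪ m ∣ n ⟫
  k-left x x∈ mn≤x with intG-left {k = k} x∈
  ... | _ , refl = ≤g⁻ˡ mn≤x (here refl) (intG-mono (i≤j⇒pred[i]≤j (<suc⇒≤ {b = m} (<-≤-trans k<n n≤1+m))))

  mn-right : ∀ y → y ∈ right ⟪ m ∣ n ⟫ → intG k ≱g y
  mn-right _ (here refl) = intG-<⇒≰ k<n

⟪⟫≤intG⁺ : n ≤ sucℤ m → m < k → ⟪ m ∣ n ⟫ ≤g intG k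
⟪⟫≤intG⁺ {n} {m} {k} n≤1+m m<k = ≤g⁺ mn-left k-right
  where
  mn-left : ∀ x → x ∈ left ⟪ m ∣ n ⟫ → x ≱g intG k
  mn-left _ (here refl) = intG-<⇒≰ m<k

  k-right : ∀ y → y ∈ right (intG k) → ⟪ m ∣ n ⟫ ≱g y
  k-right y y∈ y≤mn with intG-right {k = k} y∈
  ... | _ , refl = ≤g⁻ʳ y≤mn (here refl)
                     (intG-mono (≤-trans n≤1+m (≤-trans (i<j⇒suc[i]≤j m<k) (i≤suc[i] k))))

intG≈⟪pred∣suc⟫ : ∀ v → intG v ≈g ⟪ pred v ∣ sucℤ v ⟫
intG≈⟪pred∣suc⟫ v = ≈g-sym (≈intG⁺ v
  (λ { _ (here refl) → intG-<⇒≰ (i≤pred[j]⇒i<j {j = v} ≤-refl) })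
  (λ { _ (here refl) → intG-<⇒≰ (suc[i]≤j⇒i<j {i = v} ≤-refl) })
  (λ _ → intG (pred v) , here refl , ≤g-refl _)
  (λ _ → intG (sucℤ v) , here refl , ≤g-refl _))

≈⟨best∣best⟩ : ∀ {a b} → x ∈ left G → a ≤g x → (∀ x → x ∈ left G → x ≤g a) →
  y ∈ right G → y ≤g b → (∀ y → y ∈ right G → b ≤g y) → G ≈g ⟨ a ∷ [] ∣ b ∷ [] ⟩
≈⟨best∣best⟩ x∈ a≤x ≤a y∈ y≤b b≤ =
  ≤g⁺ (λ x' x'∈ ab≤x' → left≱ (here refl) (≤g-trans ab≤x' (≤a x' x'∈)))
      (λ { _ (here refl) b≤G → ≱right y∈ (≤g-trans y≤b b≤G) }) ,
  ≤g⁺ (λ { _ (here refl) G≤a → left≱ x∈ (≤g-trans G≤a a≤x) })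
      (λ y' y'∈ y'≤ab → ≱right (here refl) (≤g-trans (b≤ y' y'∈) y'≤ab))

attRS⁻ : AttRS xs s → Σ Game λ x → x ∈ xs × RSis x s
attRS⁻ {xs = x ∷ _} (inj₁ p) = x , here refl , p
attRS⁻ {xs = _ ∷ _} (inj₂ p) with attRS⁻ p
... | x , x∈ , q = x , there x∈ , q

attRS⁺ : x ∈ xs → RSis x s → AttRS xs s
attRS⁺ (here refl) p = inj₁ p
attRS⁺ (there x∈) p = inj₂ (attRS⁺ x∈ p)

attLS⁻ : AttLS xs s → Σ Game λ x → x ∈ xs × LSis x s
attLS⁻ {xs = x ∷ _} (inj₁ p) = x , here refl , p
attLS⁻ {xs = _ ∷ _} (inj₂ p) with attLS⁻ p
... | x , x∈ , q = x , there x∈ , q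

attLS⁺ : x ∈ xs → LSis x s → AttLS xs s
attLS⁺ (here refl) p = inj₁ p
attLS⁺ (there x∈) p = inj₂ (attLS⁺ x∈ p)

RSAtMost : Game → ℤ → Set
RSAtMost x a = ∀ t → RSis x t → t ≤ a

LSAtLeast : Game → ℤ → Set
LSAtLeast y b = ∀ t → LSis y t → b ≤ t

upperRS⁻ : UpperRS xs s → x ∈ xs → RSAtMost x s
upperRS⁻ {xs = _ ∷ _} (p , _) (here refl) = p
upperRS⁻ {xs = _ ∷ _} (_ , ps) (there x∈) = upperRS⁻ ps x∈

upperRS⁺ : ∀ xs → (∀ x → x ∈ xs → RSAtMost x s) → UpperRS xs s
upperRS⁺ [] _ = tt
upperRS⁺ (x ∷ xs) f = f x (here refl) , upperRS⁺ xs (λ z z∈ → f z (there z∈))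

lowerLS⁻ : LowerLS xs s → y ∈ xs → LSAtLeast y s
lowerLS⁻ {xs = _ ∷ _} (p , _) (here refl) = p
lowerLS⁻ {xs = _ ∷ _} (_ , ps) (there y∈) = lowerLS⁻ ps y∈

lowerLS⁺ : ∀ xs → (∀ y → y ∈ xs → LSAtLeast y s) → LowerLS xs s
lowerLS⁺ [] _ = tt
lowerLS⁺ (y ∷ ys) f = f y (here refl) , lowerLS⁺ ys (λ z z∈ → f z (there z∈))

LSis-int : G ≈g intG v → LSis G v
LSis-int {G = ⟨ _ ∣ _ ⟩} G≈v = inj₁ G≈v

RSis-int : G ≈g intG v → RSis G v
RSis-int {G = ⟨ _ ∣ _ ⟩} G≈v = inj₁ G≈v

LSis-unique : LSis G s → LSis G t → s ≡ t
LSis-unique {G = ⟨ _ ∣ _ ⟩} (inj₁ G≈s) (inj₁ G≈t) = ≈intG-unique G≈s G≈t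
LSis-unique {G = ⟨ _ ∣ _ ⟩} {s} (inj₁ G≈s) (inj₂ (¬int , _)) = ⊥-elim (¬int (s , G≈s))
LSis-unique {G = ⟨ _ ∣ _ ⟩} {t = t} (inj₂ (¬int , _)) (inj₁ G≈t) = ⊥-elim (¬int (t , G≈t))
LSis-unique {G = ⟨ _ ∣ _ ⟩} (inj₂ (_ , att , up)) (inj₂ (_ , att' , up')) with attRS⁻ att | attRS⁻ att'
... | x , x∈ , RS=s | x' , x'∈ , RS=t = ≤-antisym (upperRS⁻ up' x∈ _ RS=s) (upperRS⁻ up x'∈ _ RS=t)

RSis-unique : RSis G s → RSis G t → s ≡ t
RSis-unique {G = ⟨ _ ∣ _ ⟩} (inj₁ G≈s) (inj₁ G≈t) = ≈intG-unique G≈s G≈t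
RSis-unique {G = ⟨ _ ∣ _ ⟩} {s} (inj₁ G≈s) (inj₂ (¬int , _)) = ⊥-elim (¬int (s , G≈s))
RSis-unique {G = ⟨ _ ∣ _ ⟩} {t = t} (inj₂ (¬int , _)) (inj₁ G≈t) = ⊥-elim (¬int (t , G≈t))
RSis-unique {G = ⟨ _ ∣ _ ⟩} (inj₂ (_ , att , low)) (inj₂ (_ , att' , low')) with attLS⁻ att | attLS⁻ att'
... | y , y∈ , LS=s | y' , y'∈ , LS=t = ≤-antisym (lowerLS⁻ low y'∈ _ LS=t) (lowerLS⁻ low' y∈ _ LS=s)

LSis⁺ : ¬ IsInt G → x ∈ left G → RSis x a → (∀ x → x ∈ left G → RSAtMost x a) → LSis G a
LSis⁺ {G = ⟨ L ∣ _ ⟩} ¬int x∈ RS=a bound = inj₂ (¬int , attRS⁺ x∈ RS=a , upperRS⁺ L bound)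

RSis⁺ : ¬ IsInt G → y ∈ right G → LSis y b → (∀ y → y ∈ right G → LSAtLeast y b) → RSis G b
RSis⁺ {G = ⟨ _ ∣ R ⟩} ¬int y∈ LS=b bound = inj₂ (¬int , attLS⁺ y∈ LS=b , lowerLS⁺ R bound)

LSis⇒RSAtMost : ¬ IsInt G → LSis G a → x ∈ left G → RSAtMost x a
LSis⇒RSAtMost {G = ⟨ _ ∣ _ ⟩} {a} ¬int (inj₁ G≈a) = ⊥-elim (¬int (a , G≈a))
LSis⇒RSAtMost {G = ⟨ _ ∣ _ ⟩} _ (inj₂ (_ , _ , up)) = upperRS⁻ up

RSis⇒LSAtLeast : ¬ IsInt G → RSis G b → y ∈ right G → LSAtLeast y b
RSis⇒LSAtLeast {G = ⟨ _ ∣ _ ⟩} {b} ¬int (inj₁ G≈b) = ⊥-elim (¬int (b , G≈b))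
RSis⇒LSAtLeast {G = ⟨ _ ∣ _ ⟩} _ (inj₂ (_ , _ , low)) = lowerLS⁻ low

record StopGame (G : Game) : Set where
  field
    ls rs : ℤ
    rs≤1+ls : rs ≤ sucℤ ls
    ≈⟪ls∣rs⟫ : G ≈g ⟪ ls ∣ rs ⟫
    ls-is : LSis G ls
    rs-is : RSis G rs

IntOrStopGame : Game → Set
IntOrStopGame G = IsInt G ⊎ StopGame G

intOrStopGame⇒≈⟪⟫ : IntOrStopGame G → Σ ℤ λ m → Σ ℤ λ n → G ≈g ⟪ m ∣ n ⟫
intOrStopGame⇒≈⟪⟫ (inj₁ (v , G≈v)) = pred v , sucℤ v , ≈g-trans G≈v (intG≈⟪pred∣suc⟫ v)
intOrStopGame⇒≈⟪⟫ (inj₂ S) = ls , rs , ≈⟪ls∣rs⟫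
  where open StopGame S

int≤-past-RS : IntOrStopGame x → RSAtMost x a → a ≤ k → intG k ≤g x → k ≡ a × x ≈g intG a
int≤-past-RS {x} {a} {k} (inj₁ (v , x≈v)) RS≤a a≤k k≤x = k≡a , subst (λ w → x ≈g intG w) v≡a x≈v
  where
  v≤a : v ≤ a
  v≤a = RS≤a v (RSis-int x≈v)
  k≤v : k ≤ v
  k≤v = intG-≤⁻ (≤g-trans k≤x (proj₁ x≈v))
  k≡a : k ≡ a
  k≡a = ≤-antisym (≤-trans k≤v v≤a) a≤k
  v≡a : v ≡ a
  v≡a = ≤-antisym v≤a (≤-trans a≤k k≤v)
int≤-past-RS (inj₂ S) RS≤a a≤k k≤x =
  ⊥-elim (<⇒≱ (intG≤⟪⟫⁻ {m = ls} {n = rs} (≤g-trans k≤x (proj₁ ≈⟪ls∣rs⟫)))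
               (≤-trans (RS≤a rs rs-is) a≤k))
  where open StopGame S

≤int-past-LS : IntOrStopGame y → LSAtLeast y b → k ≤ b → y ≤g intG k → k ≡ b × y ≈g intG b
≤int-past-LS {y} {b} {k} (inj₁ (v , y≈v)) b≤LS k≤b y≤k = k≡b , subst (λ w → y ≈g intG w) v≡b y≈v
  where
  b≤v : b ≤ v
  b≤v = b≤LS v (LSis-int y≈v)
  v≤k : v ≤ k
  v≤k = intG-≤⁻ (≤g-trans (proj₂ y≈v) y≤k)
  k≡b : k ≡ b
  k≡b = ≤-antisym k≤b (≤-trans b≤v v≤k)
  v≡b : v ≡ b
  v≡b = ≤-antisym (≤-trans v≤k k≤b) b≤v
≤int-past-LS (inj₂ S) b≤LS k≤b y≤k =
  ⊥-elim (<⇒≱ (⟪⟫≤intG⁻ {m = ls} {n = rs} (≤g-trans (proj₂ ≈⟪ls∣rs⟫) y≤k))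
               (≤-trans k≤b (b≤LS ls ls-is)))
  where open StopGame S

-- The integer bounds determined by guide options

LeftGuideEnd : Game → Game → Set
LeftGuideEnd G GL = Σ ℤ λ lo → LowerEnd G lo × (∀ h → h < lo → intG h ≤g GL)

RightGuideEnd : Game → Game → Set
RightGuideEnd G GR = Σ ℤ λ hi → UpperEnd G hi × (∀ h → hi < h → GR ≤g intG h)

leftGuideEnd : gdL G GL → (∀ x → x ∈ left G → IntOrStopGame x) → LeftGuideEnd G GL
leftGuideEnd {G} {GL} (¬int , GL∈ , a , LS=a , guide) good = fromGuide guide
  where
  LeftEqualsA : Set
  LeftEqualsA = Σ Game λ K → K ∈ left G × K ≈g intG a

  past : ∀ {x k} → x ∈ left G → a ≤ k → intG k ≤g x → k ≡ a × x ≈g intG a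
  past x∈ = int≤-past-RS (good _ x∈) (LSis⇒RSAtMost ¬int LS=a x∈)

  end : ∀ lo → (∀ k → lo ≤ k → AboveLeft G k) → (∀ h → h < lo → intG h ≤g GL) → LeftGuideEnd G GL
  end lo above below = lo , (above , λ _ → leftReaches {G = G} {lo = lo} GL∈ below) , below

  -- lo = a + 1 if some Left option equals a; otherwise lo = a, and Gᴸ = {m ∣ a}.
  fromGuide : (LeftEqualsA × GL ≈g intG a) ⊎ (¬ LeftEqualsA × RSis GL a) → LeftGuideEnd G GL
  fromGuide (inj₁ (_ , GL≈a)) = end (sucℤ a)
    (λ k 1+a≤k x x∈ k≤x → <-irrefl (sym (proj₁ (past x∈ (≤-trans (i≤suc[i] a) 1+a≤k) k≤x)))
                                   (suc[i]≤j⇒i<j 1+a≤k))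
    (λ h h<1+a → ≤g-trans (intG-mono (<suc⇒≤ {b = a} h<1+a)) (proj₂ GL≈a))
  fromGuide (inj₂ (no-left≈a , RS[GL]=a)) = end a
    (λ k a≤k x x∈ k≤x → no-left≈a (x , x∈ , proj₂ (past x∈ a≤k k≤x)))
    below
    where
    below : ∀ h → h < a → intG h ≤g GL
    below h h<a with good GL GL∈
    ... | inj₁ (v , GL≈v) = ⊥-elim (no-left≈a (GL , GL∈ ,
            subst (λ w → GL ≈g intG w) (RSis-unique (RSis-int {v = v} GL≈v) RS[GL]=a) GL≈v))
    ... | inj₂ S = ≤g-trans
            (intG≤⟪⟫⁺ {m = ls} rs≤1+ls (subst (h <_) (sym (RSis-unique rs-is RS[GL]=a)) h<a))
            (proj₂ ≈⟪ls∣rs⟫)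
      where open StopGame S

rightGuideEnd : gdR G GR → (∀ y → y ∈ right G → IntOrStopGame y) → RightGuideEnd G GR
rightGuideEnd {G} {GR} (¬int , GR∈ , b , RS=b , guide) good = fromGuide guide
  where
  RightEqualsB : Set
  RightEqualsB = Σ Game λ K → K ∈ right G × K ≈g intG b

  past : ∀ {y k} → y ∈ right G → k ≤ b → y ≤g intG k → k ≡ b × y ≈g intG b
  past y∈ = ≤int-past-LS (good _ y∈) (RSis⇒LSAtLeast ¬int RS=b y∈)

  end : ∀ hi → (∀ k → k ≤ hi → BelowRight G k) → (∀ h → hi < h → GR ≤g intG h) → RightGuideEnd G GR
  end hi below above = hi , (below , λ _ → rightReaches {G = G} {hi = hi} GR∈ above) , above

  fromGuide : (RightEqualsB × GR ≈g intG b) ⊎ (¬ RightEqualsB × LSis GR b) → RightGuideEnd G GR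
  fromGuide (inj₁ (_ , GR≈b)) = end (pred b)
    (λ k k≤b-1 y y∈ y≤k → <-irrefl (proj₁ (past y∈ (≤-trans k≤b-1 (i≤j⇒pred[i]≤j ≤-refl)) y≤k))
                                   (i≤pred[j]⇒i<j k≤b-1))
    (λ h b-1<h → ≤g-trans (proj₁ GR≈b) (intG-mono (pred<⇒≤ {a = b} b-1<h)))
  fromGuide (inj₂ (no-right≈b , LS[GR]=b)) = end b
    (λ k k≤b y y∈ y≤k → no-right≈b (y , y∈ , proj₂ (past y∈ k≤b y≤k)))
    above
    where
    above : ∀ h → b < h → GR ≤g intG h
    above h b<h with good GR GR∈
    ... | inj₁ (v , GR≈v) = ⊥-elim (no-right≈b (GR , GR∈ ,
            subst (λ w → GR ≈g intG w) (LSis-unique (LSis-int {v = v} GR≈v) LS[GR]=b) GR≈v))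
    ... | inj₂ S = ≤g-trans
            (proj₁ ≈⟪ls∣rs⟫)
            (⟪⟫≤intG⁺ {n = rs} rs≤1+ls (subst (_< h) (sym (LSis-unique ls-is LS[GR]=b)) b<h))
      where open StopGame S

-- Positions of 𝒟

record GuideSeparator (G : Game) : Set where
  constructor separator
  field
    guideL guideR middle : Game
    guideL-is : gdL G guideL
    guideR-is : gdR G guideR
    middle-option : middle ∈ right guideL ⊎ middle ∈ left guideR
    guideL≱middle : guideL ≱g middle
    middle≱guideR : middle ≱g guideR

diamond⇒separator : HasSomeDiamond G → IsInt G ⊎ GuideSeparator G
diamond⇒separator (inj₁ (inj₁ int)) = inj₁ int
diamond⇒separator (inj₁ (inj₂ (GL , GR , gl , gr , H , H∈GLᴿ , H∈GRᴸ))) =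
  inj₂ (separator GL GR H gl gr (inj₁ H∈GLᴿ) (≱right H∈GLᴿ) (left≱ H∈GRᴸ))
diamond⇒separator (inj₂ (inj₁ (inj₁ int))) = inj₁ int
diamond⇒separator (inj₂ (inj₁ (inj₂ (GL , GR , gl , gr , GLR , GRL , GLR∈ , GRL∈ , GLR≤GRL)))) =
  inj₂ (separator GL GR GRL gl gr (inj₂ GRL∈) (≱g-≤g-trans (≱right GLR∈) GLR≤GRL) (left≱ GRL∈))
diamond⇒separator (inj₂ (inj₂ (inj₁ (inj₁ int)))) = inj₁ int
diamond⇒separator (inj₂ (inj₂ (inj₁ (inj₂ (GL , GR , gl , gr , GLR , GLR∈ , GLR≱GR))))) =
  inj₂ (separator GL GR GLR gl gr (inj₁ GLR∈) (≱right GLR∈) GLR≱GR)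
diamond⇒separator (inj₂ (inj₂ (inj₂ (inj₁ int)))) = inj₁ int
diamond⇒separator (inj₂ (inj₂ (inj₂ (inj₂ (GL , GR , gl , gr , GRL , GRL∈ , GL≱GRL))))) =
  inj₂ (separator GL GR GRL gl gr (inj₂ GRL∈) GL≱GRL (left≱ GRL∈))

guides-separated-by-int⇒isInt : gdL G GL → gdR G GR → GL ≱g intG k → intG k ≱g GR →
  (∀ x → x ∈ left G → IntOrStopGame x) → (∀ y → y ∈ right G → IntOrStopGame y) → IsInt G
guides-separated-by-int⇒isInt {k = k} gl gr GL≱k k≱GR goodL goodR
  with leftGuideEnd gl goodL | rightGuideEnd gr goodR
... | lo , lowerEnd , below | hi , upperEnd , above =
  isInt-between (≤-trans lo≤k k≤hi) lowerEnd upperEnd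
  where
  lo≤k : lo ≤ k
  lo≤k = ≮⇒≥ (λ k<lo → GL≱k (below k k<lo))
  k≤hi : k ≤ hi
  k≤hi = ≮⇒≥ (λ hi<k → k≱GR (above k hi<k))

diamond⇒isInt : HasSomeDiamond G →
  (∀ x → x ∈ left G → IntOrStopGame x) → (∀ y → y ∈ right G → IntOrStopGame y) →
  (∀ GL → GL ∈ left G → ∀ z → z ∈ right GL → IsInt z) →
  (∀ GR → GR ∈ right G → ∀ z → z ∈ left GR → IsInt z) → IsInt G
diamond⇒isInt ◇ goodL goodR intᴸᴿ intᴿᴸ with diamond⇒separator ◇
... | inj₁ int = int
... | inj₂ (separator GL GR X gl@(_ , GL∈ , _) gr@(_ , GR∈ , _) X-option GL≱X X≱GR)
  with [ intᴸᴿ GL GL∈ X , intᴿᴸ GR GR∈ X ]′ X-option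
... | k , X≈k = guides-separated-by-int⇒isInt {k = k} gl gr
                  (≱g-≤g-trans GL≱X (proj₁ X≈k)) (≤g-≱g-trans (proj₂ X≈k) X≱GR) goodL goodR

-- Positions of 𝒮

Maximum : List Game → ℤ → Set
Maximum xs a = (Σ Game λ x → x ∈ xs × x ≈g intG a) × (∀ x → x ∈ xs → x ≤g intG a)

Minimum : List Game → ℤ → Set
Minimum xs b = (Σ Game λ y → y ∈ xs × y ≈g intG b) × (∀ y → y ∈ xs → intG b ≤g y)

maximum : ∀ x xs → (∀ z → z ∈ x ∷ xs → IsInt z) → Σ ℤ (Maximum (x ∷ xs))
maximum x [] ints with ints x (here refl)
... | a , x≈a = a , (x , here refl , x≈a) , λ { _ (here refl) → proj₁ x≈a ; _ (there ()) }
maximum x (x' ∷ xs) ints with ints x (here refl) | maximum x' xs (λ z z∈ → ints z (there z∈))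
... | a , x≈a | b , (z , z∈ , z≈b) , ≤b with a ≤? b
...   | yes a≤b = b , (z , there z∈ , z≈b) ,
          λ { _ (here refl) → ≤g-trans (proj₁ x≈a) (intG-mono a≤b) ; w (there w∈) → ≤b w w∈ }
...   | no a≰b = a , (x , here refl , x≈a) ,
          λ { _ (here refl) → proj₁ x≈a ; w (there w∈) → ≤g-trans (≤b w w∈) (intG-mono (<⇒≤ (≰⇒> a≰b))) }

minimum : ∀ y ys → (∀ z → z ∈ y ∷ ys → IsInt z) → Σ ℤ (Minimum (y ∷ ys))
minimum y [] ints with ints y (here refl)
... | b , y≈b = b , (y , here refl , y≈b) , λ { _ (here refl) → proj₂ y≈b ; _ (there ()) }
minimum y (y' ∷ ys) ints with ints y (here refl) | minimum y' ys (λ z z∈ → ints z (there z∈))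
... | b , y≈b | a , (z , z∈ , z≈a) , a≤ with a ≤? b
...   | yes a≤b = a , (z , there z∈ , z≈a) ,
          λ { _ (here refl) → ≤g-trans (intG-mono a≤b) (proj₂ y≈b) ; w (there w∈) → a≤ w w∈ }
...   | no a≰b = b , (y , here refl , y≈b) ,
          λ { _ (here refl) → proj₂ y≈b ; w (there w∈) → ≤g-trans (intG-mono (<⇒≤ (≰⇒> a≰b))) (a≤ w w∈) }

lowerEnd-max : Maximum (left G) a → LowerEnd G (sucℤ a)
lowerEnd-max {G} {a} ((x , x∈ , x≈a) , ≤a) =
  (λ k 1+a≤k z z∈ k≤z →
    <⇒≱ (suc[i]≤j⇒i<j 1+a≤k) (intG-≤⁻ {a = k} {b = a} (≤g-trans k≤z (≤a z z∈)))) ,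
  (λ _ → leftReaches {G = G} x∈ (λ h h<1+a → ≤g-trans (intG-mono (<suc⇒≤ {b = a} h<1+a)) (proj₂ x≈a)))

upperEnd-min : Minimum (right G) b → UpperEnd G (pred b)
upperEnd-min {G} {b} ((y , y∈ , y≈b) , b≤) =
  (λ k k≤b-1 z z∈ z≤k →
    <⇒≱ (i≤pred[j]⇒i<j k≤b-1) (intG-≤⁻ {a = b} {b = k} (≤g-trans (b≤ z z∈) z≤k))) ,
  (λ _ → rightReaches {G = G} y∈ (λ h b-1<h → ≤g-trans (proj₁ y≈b) (intG-mono (pred<⇒≤ {a = b} b-1<h))))

lowerEnd-[] : ∀ {R} → lo ≤ 0ℤ → LowerEnd ⟨ [] ∣ R ⟩ lo
lowerEnd-[] lo≤0 = (λ _ _ _ ()) , (λ 0<lo → ⊥-elim (<⇒≱ 0<lo lo≤0))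

upperEnd-[] : ∀ {L} → 0ℤ ≤ hi → UpperEnd ⟨ L ∣ [] ⟩ hi
upperEnd-[] 0≤hi = (λ _ _ _ ()) , (λ hi<0 → ⊥-elim (<⇒≱ hi<0 0≤hi))

RSAtMost-int : IsInt x → x ≤g intG a → RSAtMost x a
RSAtMost-int {a = a} (v , x≈v) x≤a t RS=t =
  subst (_≤ a) (RSis-unique (RSis-int {v = v} x≈v) RS=t) (intG-≤⁻ (≤g-trans (proj₂ x≈v) x≤a))

LSAtLeast-int : IsInt y → intG b ≤g y → LSAtLeast y b
LSAtLeast-int {b = b} (v , y≈v) b≤y t LS=t =
  subst (b ≤_) (LSis-unique (LSis-int {v = v} y≈v) LS=t) (intG-≤⁻ (≤g-trans b≤y (proj₁ y≈v)))

extremes⇒stopGame : (∀ x → x ∈ left G → IsInt x) → (∀ y → y ∈ right G → IsInt y) →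
  Maximum (left G) a → Minimum (right G) b → b ≤ sucℤ a → StopGame G
extremes⇒stopGame {G} {a} {b} intL intR ((x , x∈ , x≈a) , ≤a) ((y , y∈ , y≈b) , b≤) b≤1+a = record
  { ls = a
  ; rs = b
  ; rs≤1+ls = b≤1+a
  ; ≈⟪ls∣rs⟫ = ≈⟨best∣best⟩ {G = G} x∈ (proj₂ x≈a) ≤a y∈ (proj₁ y≈b) b≤
  ; ls-is = LSis⁺ ¬int x∈ (RSis-int {v = a} x≈a) (λ z z∈ → RSAtMost-int {a = a} (intL z z∈) (≤a z z∈))
  ; rs-is = RSis⁺ ¬int y∈ (LSis-int {v = b} y≈b) (λ z z∈ → LSAtLeast-int {b = b} (intR z z∈) (b≤ z z∈))
  }
  where
  ¬int : ¬ IsInt G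
  ¬int (k , G≈k) = <⇒≱ (≤-<-trans (i<j⇒suc[i]≤j a<k) k<b) b≤1+a
    where
    a<k : a < k
    a<k = intG-≰⁻ (λ k≤a → left≱ x∈ (≤g-trans (proj₁ G≈k) (≤g-trans k≤a (proj₂ x≈a))))
    k<b : k < b
    k<b = intG-≰⁻ (λ b≤k → ≱right y∈ (≤g-trans (proj₁ y≈b) (≤g-trans b≤k (proj₂ G≈k))))

intOptions⇒intOrStopGame : ∀ G → (∀ x → x ∈ left G → IsInt x) → (∀ y → y ∈ right G → IsInt y) →
  IntOrStopGame G
intOptions⇒intOrStopGame ⟨ [] ∣ [] ⟩ _ _ = inj₁ (0ℤ , ≈g-refl)
intOptions⇒intOrStopGame G@(⟨ [] ∣ y ∷ ys ⟩) _ intR with minimum y ys intR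
... | b , min = inj₁ (isInt-between (i⊓j≤i (pred b) 0ℤ) (lowerEnd-[] {R = y ∷ ys} (i⊓j≤j (pred b) 0ℤ))
                                    (upperEnd-min {G = G} {b = b} min))
intOptions⇒intOrStopGame G@(⟨ x ∷ xs ∣ [] ⟩) intL _ with maximum x xs intL
... | a , max = inj₁ (isInt-between (i≤i⊔j (sucℤ a) 0ℤ) (lowerEnd-max {G = G} {a = a} max)
                                    (upperEnd-[] {L = x ∷ xs} (i≤j⊔i (sucℤ a) 0ℤ)))
intOptions⇒intOrStopGame G@(⟨ x ∷ xs ∣ y ∷ ys ⟩) intL intR with maximum x xs intL | minimum y ys intR
... | a , max | b , min with sucℤ a <? b
...   | yes 1+a<b = inj₁ (isInt-between (i<j⇒i≤pred[j] 1+a<b) (lowerEnd-max {G = G} {a = a} max)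
                                        (upperEnd-min {G = G} {b = b} min))
...   | no 1+a≮b = inj₂ (extremes⇒stopGame {G = G} {a = a} {b = b} intL intR max min (≮⇒≥ 1+a≮b))

corollary2 : (𝒢 𝒟 𝒮 : Game → Set) →
    ClosedUnderOptions 𝒢 →
    IsPartition 𝒢 𝒟 𝒮 →
    (∀ G → 𝒟 G → HasSomeDiamond G) →
    (∀ G → 𝒮 G → (∀ K → K ∈ left G → 𝒟 K) × (∀ K → K ∈ right G → 𝒟 K)) →
    (∀ G → 𝒟 G →
      (∀ GL → GL ∈ left G → ∀ K → K ∈ right GL → 𝒟 K) ×
      (∀ GR → GR ∈ right G → ∀ K → K ∈ left GR → 𝒟 K)) →
    (∀ G → 𝒢 G → Σ ℤ λ m → Σ ℤ λ n → G ≈g ⟨ intG m ∷ [] ∣ intG n ∷ [] ⟩) ×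
    (∀ G → 𝒟 G → IsInt G)
corollary2 𝒢 𝒟 𝒮 closed (𝒢⊆𝒟⊎𝒮 , 𝒟⊆𝒢 , _ , _) diamond 𝒮-options 𝒟-options =
  (λ G G∈𝒢 → intOrStopGame⇒≈⟪⟫ (proj₁ (claim G) G∈𝒢)) , (λ G G∈𝒟 → proj₂ (claim G) G∈𝒟)
  where
  Claim : Game → Set
  Claim G = (𝒢 G → IntOrStopGame G) × (𝒟 G → IsInt G)

  step : ∀ G → (∀ H → size H ℕ.< size G → Claim H) → Claim G
  step G ih = (λ G∈𝒢 → [ inj₁ ∘ 𝒟⇒isInt , 𝒮⇒intOrStopGame ]′ (𝒢⊆𝒟⊎𝒮 G G∈𝒢)) , 𝒟⇒isInt
    where
    𝒟⇒isInt : 𝒟 G → IsInt G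
    𝒟⇒isInt G∈𝒟 = diamond⇒isInt (diamond G G∈𝒟)
      (λ x x∈ → proj₁ (ih x (left-size x∈)) (proj₁ (closed G (𝒟⊆𝒢 G G∈𝒟)) x x∈))
      (λ y y∈ → proj₁ (ih y (right-size y∈)) (proj₂ (closed G (𝒟⊆𝒢 G G∈𝒟)) y y∈))
      (λ x x∈ z z∈ → proj₂ (ih z (ℕ.<-trans (right-size z∈) (left-size x∈)))
                           (proj₁ (𝒟-options G G∈𝒟) x x∈ z z∈))
      (λ y y∈ z z∈ → proj₂ (ih z (ℕ.<-trans (left-size z∈) (right-size y∈)))
                           (proj₂ (𝒟-options G G∈𝒟) y y∈ z z∈))

    𝒮⇒intOrStopGame : 𝒮 G → IntOrStopGame G
    𝒮⇒intOrStopGame G∈𝒮 = intOptions⇒intOrStopGame G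
      (λ x x∈ → proj₂ (ih x (left-size x∈)) (proj₁ (𝒮-options G G∈𝒮) x x∈))
      (λ y y∈ → proj₂ (ih y (right-size y∈)) (proj₂ (𝒮-options G G∈𝒮) y y∈))

  claim : ∀ G → Claim G
  claim = size-rec Claim step
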